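{- Let $f(x)=\dfrac{1-\sqrt{1-\frac{4x^4}{1-x^2}}}{2x^4}$. Then $f=\mathbf{J}[\mathbf{u}/\mathbf{v}]$ where $u_k=0$ for all $k\ge1$, $v_0=1$, and for every integer $k\ge0$: $v_{4k+1}=k+1$, $v_{4k+2}=1/(k+1)$, $v_{4k+3}=-1/(k+1)$, $v_{4k+4}=-(k+1)$; i.e. $\mathbf{v}=(1,1,1,-1,-1,2,\tfrac12,-\tfrac12,-2,3,\tfrac13,-\tfrac13,-3,\dots)$.
   Context: The square root is the formal power series with constant term $1$. For sequences $\mathbf{u}=(u_1,u_2,\dots)$, $\mathbf{v}=(v_0,v_1,\dots)$, $\mathbf{J}[\mathbf{u}/\mathbf{v}]$ denotes the formal power series $\cfrac{v_0}{1+u_1x-\cfrac{v_1x^2}{1+u_2x-\cfrac{v_2x^2}{1+u_3x-\cdots}}}$. -}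

module Defs where

open import Data.Nat as ℕ using (ℕ; zero; suc; _∸_; _≤_)
open import Data.Integer using (+_)
open import Data.Rational using (ℚ; 0ℚ; 1ℚ; _+_; _*_; -_; _-_; _/_)
open import Data.List using (List; foldr; map; upTo)
open import Data.Fin using (Fin; toℕ)
open import Data.Vec as Vec using (Vec; _∷_; []; head; tabulate; zipWith)
open import Relation.Binary.PropositionalEquality using (_≡_)
open import Relation.Nullary using (yes; no)
open import Data.Product using (∃)

PS : Set
PS = ℕ → ℚ

_≈ₚ_ : PS → PS → Set
f ≈ₚ g = ∀ n → f n ≡ g n
infix 4 _≈ₚ_

const : ℚ → PS
const c zero    = c
const c (suc _) = 0ℚ

X^ : ℕ → PS
X^ k n with k ℕ.≟ n
... | yes _ = 1ℚ
... | no  _ = 0ℚ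

_+ₚ_ : PS → PS → PS
(f +ₚ g) n = f n + g n

_-ₚ_ : PS → PS → PS
(f -ₚ g) n = f n - g n

_·ₚ_ : ℚ → PS → PS
(c ·ₚ f) n = c * f n

sumℚ : List ℚ → ℚ
sumℚ = foldr _+_ 0ℚ

_*ₚ_ : PS → PS → PS
(f *ₚ g) n = sumℚ (map (λ i → f i * g (n ∸ i)) (upTo (suc n)))

infixl 6 _+ₚ_ _-ₚ_
infixl 7 _*ₚ_ _·ₚ_

-- Reciprocal of a series with constant term 1 (the constant term of the
-- argument is not inspected: it is assumed to be 1).
-- invVec a n = (b_n , b_{n-1} , … , b_0) where b_0 = 1 and
-- b_m = - Σ_{i=1}^{m} a_i b_{m-i}.
invVec : PS → (n : ℕ) → Vec ℚ (suc n)
invVec a zero    = 1ℚ ∷ []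
invVec a (suc n) =
  (- Vec.foldr _ _+_ 0ℚ (zipWith _*_ (tabulate (λ (i : Fin (suc n)) → a (suc (toℕ i)))) prev))
  ∷ prev
  where prev = invVec a n

inv₁ : PS → PS
inv₁ a n = head (invVec a n)

-- G m j = 1/(1 + u_j x - v_j x^2 · G (m-1) (j+1)),  G 0 j = 0,
-- so that  Jtrunc u v m = v_0 · G m 1
--   = v_0/(1+u_1x - v_1x^2/(1+u_2x - … - v_{m-1}x^2/(1+u_m x))).
G : (ℕ → ℚ) → (ℕ → ℚ) → ℕ → ℕ → PS
G u v zero    j = const 0ℚ
G u v (suc m) j =
  inv₁ (const 1ℚ +ₚ u j ·ₚ X^ 1 -ₚ v j ·ₚ (X^ 2 *ₚ G u v m (suc j)))

Jtrunc : (ℕ → ℚ) → (ℕ → ℚ) → ℕ → PS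
Jtrunc u v m = v 0 ·ₚ G u v m 1

-- f = J[u/v]: the truncations converge to f in the formal (x-adic) topology,
-- i.e. every coefficient of the truncations eventually equals that of f.
IsJFraction : PS → (ℕ → ℚ) → (ℕ → ℚ) → Set
IsJFraction f u v =
  ∀ n → ∃ λ N → ∀ m → N ≤ m → Jtrunc u v m n ≡ f n

-- Write Y = x². Since 1 - s = 2Y²f, comparing s² = (1 - 2Y²f)² with the hypothesis on s² and
-- cancelling 4Y² gives the quadratic equation (1 - Y)(f - Y²f²) = 1. Modulo this equation the series
--   A_K = f / (1 - KYf),  B_c = 1 + cY(1 - Y)f,  C_c = 1 / (1 + cY - Y²f),  D_P = 1 - PYf
-- satisfy T = 1 / (1 - wYT') along A_k → B_{1/(k+1)} → C_{1/(k+1)} → D_{k+1} → A_{k+1}, with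
-- w = v_{4k+1}, …, v_{4k+4} respectively; so they are the tails T_{4k}, …, T_{4k+3} of the
-- J-fraction, and T_0 = A_0 = f. Finally, any sequence of tails T_i = 1 / (1 + u_{i+1}x - v_{i+1}x²T_{i+1})
-- determines v_0 T_0 = J[u/v]: replacing T_{i+1} by an approximation changes the denominator
-- only from degree 2 on, so the m-th truncation agrees with v_0 T_0 below degree m.

module Submission where

open import Defs
open import Data.Nat using (ℕ; suc; _+_; _*_)
open import Data.Integer using (+_)
open import Data.Rational using (ℚ; 0ℚ; 1ℚ; -_; _/_)
open import Relation.Binary.PropositionalEquality using (_≡_)

open import Data.Nat using (zero; _∸_; _<_; z<s; s≤s)
import Data.Nat.Properties as ℕₚ
import Data.Rational as ℚ
import Data.Rational.Properties as ℚₚ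
import Data.Rational.Unnormalised as ℚᵘ
import Data.Rational.Unnormalised.Properties as ℚᵘₚ
open import Data.Rational.Solver using () renaming (module +-*-Solver to ℚ-Solver)
open import Data.Integer.Solver using () renaming (module +-*-Solver to ℤ-Solver)
open import Data.Nat.Solver using () renaming (module +-*-Solver to ℕ-Solver)
open import Data.List using (applyUpTo)
open import Data.List.Properties using (map-applyUpTo)
open import Relation.Binary.PropositionalEquality
  using (refl; sym; trans; cong; cong₂; module ≡-Reasoning)
open import Function using (id)
open import Data.Product using (_,_)
open import Data.Sum using (inj₁; inj₂)
open import Data.Maybe as Maybe using (Maybe)
open import Relation.Nullary.Decidable using (dec⇒maybe)
open import Relation.Binary.Structures using (IsEquivalence)
open import Level using (0ℓ)
open import Algebra.Bundles using (CommutativeRing)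
open import Algebra.Structures using (IsCommutativeRing)
open import Algebra.Solver.Ring.AlmostCommutativeRing
  using (fromCommutativeRing; _-Raw-AlmostCommutative⟶_)
import Algebra.Solver.Ring
open import Data.Fin using (Fin; toℕ) renaming (zero to fzero; suc to fsuc)
open import Data.Vec as Vec using (Vec; _∷_; []; lookup; tabulate; zipWith)

-- The ring of formal power series

tail : PS → PS
tail f n = f (suc n)

0ₚ : PS
0ₚ _ = 0ℚ

1ₚ : PS
1ₚ = const 1ℚ

-ₚ_ : PS → PS
(-ₚ f) n = - f n

infix 8 -ₚ_

*ₚ-applyUpTo : (f g : PS) (n : ℕ) →
  (f *ₚ g) n ≡ sumℚ (applyUpTo (λ i → f i ℚ.* g (n ∸ i)) (suc n))
*ₚ-applyUpTo f g n = cong sumℚ (map-applyUpTo id (λ i → f i ℚ.* g (n ∸ i)) (suc n))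

*ₚ-at-0 : (f g : PS) → (f *ₚ g) 0 ≡ f 0 ℚ.* g 0
*ₚ-at-0 f g = trans (*ₚ-applyUpTo f g 0) (ℚₚ.+-identityʳ _)

*ₚ-at-suc : (f g : PS) (n : ℕ) →
  (f *ₚ g) (suc n) ≡ f 0 ℚ.* g (suc n) ℚ.+ (tail f *ₚ g) n
*ₚ-at-suc f g n =
  trans (*ₚ-applyUpTo f g (suc n)) (cong (f 0 ℚ.* g (suc n) ℚ.+_) (sym (*ₚ-applyUpTo (tail f) g n)))

*ₚ-congʳ : {a b : PS} (h : PS) → a ≈ₚ b → a *ₚ h ≈ₚ b *ₚ h
*ₚ-congʳ {a} {b} h a≈b zero =
  trans (*ₚ-at-0 a h) (trans (cong (ℚ._* h 0) (a≈b 0)) (sym (*ₚ-at-0 b h)))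
*ₚ-congʳ {a} {b} h a≈b (suc n) = trans (*ₚ-at-suc a h n) (trans
  (cong₂ ℚ._+_ (cong (ℚ._* h (suc n)) (a≈b 0)) (*ₚ-congʳ h (λ i → a≈b (suc i)) n))
  (sym (*ₚ-at-suc b h n)))

*ₚ-congˡ : {a b : PS} (h : PS) → a ≈ₚ b → h *ₚ a ≈ₚ h *ₚ b
*ₚ-congˡ {a} {b} h a≈b zero =
  trans (*ₚ-at-0 h a) (trans (cong (h 0 ℚ.*_) (a≈b 0)) (sym (*ₚ-at-0 h b)))
*ₚ-congˡ {a} {b} h a≈b (suc n) = trans (*ₚ-at-suc h a n) (trans
  (cong₂ ℚ._+_ (cong (h 0 ℚ.*_) (a≈b (suc n))) (*ₚ-congˡ (tail h) a≈b n))
  (sym (*ₚ-at-suc h b n)))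

*ₚ-zeroˡ : (h : PS) → 0ₚ *ₚ h ≈ₚ 0ₚ
*ₚ-zeroˡ h zero = trans (*ₚ-at-0 0ₚ h) (ℚₚ.*-zeroˡ (h 0))
*ₚ-zeroˡ h (suc n) = trans (*ₚ-at-suc 0ₚ h n)
  (trans (cong₂ ℚ._+_ (ℚₚ.*-zeroˡ (h (suc n))) (*ₚ-zeroˡ h n)) (ℚₚ.+-identityˡ 0ℚ))

const-*ₚ : (c : ℚ) (h : PS) → const c *ₚ h ≈ₚ c ·ₚ h
const-*ₚ c h zero = *ₚ-at-0 (const c) h
const-*ₚ c h (suc n) = trans (*ₚ-at-suc (const c) h n)
  (trans (cong (c ℚ.* h (suc n) ℚ.+_) (*ₚ-zeroˡ h n)) (ℚₚ.+-identityʳ _))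

*ₚ-identityˡ : (h : PS) → 1ₚ *ₚ h ≈ₚ h
*ₚ-identityˡ h n = trans (const-*ₚ 1ℚ h n) (ℚₚ.*-identityˡ (h n))

*ₚ-distribʳ : (a b h : PS) → (a +ₚ b) *ₚ h ≈ₚ a *ₚ h +ₚ b *ₚ h
*ₚ-distribʳ a b h zero = trans (*ₚ-at-0 (a +ₚ b) h)
  (trans (ℚₚ.*-distribʳ-+ (h 0) (a 0) (b 0)) (sym (cong₂ ℚ._+_ (*ₚ-at-0 a h) (*ₚ-at-0 b h))))
*ₚ-distribʳ a b h (suc n) = begin
    ((a +ₚ b) *ₚ h) (suc n)
  ≡⟨ *ₚ-at-suc (a +ₚ b) h n ⟩
    (a 0 ℚ.+ b 0) ℚ.* h (suc n) ℚ.+ (tail (a +ₚ b) *ₚ h) n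
  ≡⟨ cong ((a 0 ℚ.+ b 0) ℚ.* h (suc n) ℚ.+_) (*ₚ-distribʳ (tail a) (tail b) h n) ⟩
    (a 0 ℚ.+ b 0) ℚ.* h (suc n) ℚ.+ ((tail a *ₚ h) n ℚ.+ (tail b *ₚ h) n)
  ≡⟨ solve 5 (λ x y z u w → (x :+ y) :* z :+ (u :+ w) := (x :* z :+ u) :+ (y :* z :+ w)) refl
       (a 0) (b 0) (h (suc n)) ((tail a *ₚ h) n) ((tail b *ₚ h) n) ⟩
    (a 0 ℚ.* h (suc n) ℚ.+ (tail a *ₚ h) n) ℚ.+ (b 0 ℚ.* h (suc n) ℚ.+ (tail b *ₚ h) n)
  ≡⟨ sym (cong₂ ℚ._+_ (*ₚ-at-suc a h n) (*ₚ-at-suc b h n)) ⟩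
    (a *ₚ h +ₚ b *ₚ h) (suc n) ∎
  where
  open ≡-Reasoning
  open ℚ-Solver

·ₚ-*ₚ-assoc : (c : ℚ) (a h : PS) → (c ·ₚ a) *ₚ h ≈ₚ c ·ₚ (a *ₚ h)
·ₚ-*ₚ-assoc c a h zero =
  trans (*ₚ-at-0 (c ·ₚ a) h) (trans (ℚₚ.*-assoc c (a 0) (h 0)) (cong (c ℚ.*_) (sym (*ₚ-at-0 a h))))
·ₚ-*ₚ-assoc c a h (suc n) = begin
    ((c ·ₚ a) *ₚ h) (suc n)
  ≡⟨ *ₚ-at-suc (c ·ₚ a) h n ⟩
    (c ℚ.* a 0) ℚ.* h (suc n) ℚ.+ ((c ·ₚ tail a) *ₚ h) n
  ≡⟨ cong ((c ℚ.* a 0) ℚ.* h (suc n) ℚ.+_) (·ₚ-*ₚ-assoc c (tail a) h n) ⟩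
    (c ℚ.* a 0) ℚ.* h (suc n) ℚ.+ c ℚ.* (tail a *ₚ h) n
  ≡⟨ solve 4 (λ c x z u → (c :* x) :* z :+ c :* u := c :* (x :* z :+ u)) refl
       c (a 0) (h (suc n)) ((tail a *ₚ h) n) ⟩
    c ℚ.* (a 0 ℚ.* h (suc n) ℚ.+ (tail a *ₚ h) n)
  ≡⟨ sym (cong (c ℚ.*_) (*ₚ-at-suc a h n)) ⟩
    (c ·ₚ (a *ₚ h)) (suc n) ∎
  where
  open ≡-Reasoning
  open ℚ-Solver

*ₚ-comm : (f g : PS) → f *ₚ g ≈ₚ g *ₚ f
*ₚ-comm f g zero = trans (*ₚ-at-0 f g) (trans (ℚₚ.*-comm (f 0) (g 0)) (sym (*ₚ-at-0 g f)))
*ₚ-comm f g (suc zero) = begin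
    (f *ₚ g) 1
  ≡⟨ trans (*ₚ-at-suc f g 0) (cong (f 0 ℚ.* g 1 ℚ.+_) (*ₚ-at-0 (tail f) g)) ⟩
    f 0 ℚ.* g 1 ℚ.+ f 1 ℚ.* g 0
  ≡⟨ solve 4 (λ a b c d → a :* b :+ c :* d := d :* c :+ b :* a) refl (f 0) (g 1) (f 1) (g 0) ⟩
    g 0 ℚ.* f 1 ℚ.+ g 1 ℚ.* f 0
  ≡⟨ sym (trans (*ₚ-at-suc g f 0) (cong (g 0 ℚ.* f 1 ℚ.+_) (*ₚ-at-0 (tail g) f))) ⟩
    (g *ₚ f) 1 ∎
  where
  open ≡-Reasoning
  open ℚ-Solver
*ₚ-comm f g (suc (suc m)) = begin
    (f *ₚ g) (2 + m)
  ≡⟨ *ₚ-at-suc f g (suc m) ⟩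
    f 0 ℚ.* g (2 + m) ℚ.+ (tail f *ₚ g) (suc m)
  ≡⟨ cong (f 0 ℚ.* g (2 + m) ℚ.+_) (trans (*ₚ-comm (tail f) g (suc m)) (*ₚ-at-suc g (tail f) m)) ⟩
    f 0 ℚ.* g (2 + m) ℚ.+ (g 0 ℚ.* f (2 + m) ℚ.+ (tail g *ₚ tail f) m)
  ≡⟨ cong (λ t → f 0 ℚ.* g (2 + m) ℚ.+ (g 0 ℚ.* f (2 + m) ℚ.+ t)) (*ₚ-comm (tail g) (tail f) m) ⟩
    f 0 ℚ.* g (2 + m) ℚ.+ (g 0 ℚ.* f (2 + m) ℚ.+ (tail f *ₚ tail g) m)
  ≡⟨ solve 5 (λ a b c d e → a :* b :+ (c :* d :+ e) := c :* d :+ (a :* b :+ e)) refl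
       (f 0) (g (2 + m)) (g 0) (f (2 + m)) ((tail f *ₚ tail g) m) ⟩
    g 0 ℚ.* f (2 + m) ℚ.+ (f 0 ℚ.* g (2 + m) ℚ.+ (tail f *ₚ tail g) m)
  ≡⟨ sym (cong (g 0 ℚ.* f (2 + m) ℚ.+_) (trans (*ₚ-comm (tail g) f (suc m)) (*ₚ-at-suc f (tail g) m))) ⟩
    g 0 ℚ.* f (2 + m) ℚ.+ (tail g *ₚ f) (suc m)
  ≡⟨ sym (*ₚ-at-suc g f (suc m)) ⟩
    (g *ₚ f) (2 + m) ∎
  where
  open ≡-Reasoning
  open ℚ-Solver

*ₚ-zeroʳ : (h : PS) → h *ₚ 0ₚ ≈ₚ 0ₚ
*ₚ-zeroʳ h n = trans (*ₚ-comm h 0ₚ n) (*ₚ-zeroˡ h n)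

*ₚ-assoc : (f g h : PS) → (f *ₚ g) *ₚ h ≈ₚ f *ₚ (g *ₚ h)
*ₚ-assoc f g h zero = begin
    ((f *ₚ g) *ₚ h) 0
  ≡⟨ trans (*ₚ-at-0 (f *ₚ g) h) (cong (ℚ._* h 0) (*ₚ-at-0 f g)) ⟩
    (f 0 ℚ.* g 0) ℚ.* h 0
  ≡⟨ ℚₚ.*-assoc (f 0) (g 0) (h 0) ⟩
    f 0 ℚ.* (g 0 ℚ.* h 0)
  ≡⟨ sym (trans (*ₚ-at-0 f (g *ₚ h)) (cong (f 0 ℚ.*_) (*ₚ-at-0 g h))) ⟩
    (f *ₚ (g *ₚ h)) 0 ∎
  where open ≡-Reasoning
*ₚ-assoc f g h (suc n) = begin
    ((f *ₚ g) *ₚ h) (suc n)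
  ≡⟨ *ₚ-at-suc (f *ₚ g) h n ⟩
    (f *ₚ g) 0 ℚ.* h (suc n) ℚ.+ (tail (f *ₚ g) *ₚ h) n
  ≡⟨ cong₂ ℚ._+_ (cong (ℚ._* h (suc n)) (*ₚ-at-0 f g)) tail-fg*h ⟩
    (f 0 ℚ.* g 0) ℚ.* h (suc n) ℚ.+ (f 0 ℚ.* (tail g *ₚ h) n ℚ.+ (tail f *ₚ (g *ₚ h)) n)
  ≡⟨ solve 5 (λ a b c d e → (a :* b) :* c :+ (a :* d :+ e) := a :* (b :* c :+ d) :+ e) refl
       (f 0) (g 0) (h (suc n)) ((tail g *ₚ h) n) ((tail f *ₚ (g *ₚ h)) n) ⟩
    f 0 ℚ.* (g 0 ℚ.* h (suc n) ℚ.+ (tail g *ₚ h) n) ℚ.+ (tail f *ₚ (g *ₚ h)) n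
  ≡⟨ cong (λ t → f 0 ℚ.* t ℚ.+ (tail f *ₚ (g *ₚ h)) n) (sym (*ₚ-at-suc g h n)) ⟩
    f 0 ℚ.* (g *ₚ h) (suc n) ℚ.+ (tail f *ₚ (g *ₚ h)) n
  ≡⟨ sym (*ₚ-at-suc f (g *ₚ h) n) ⟩
    (f *ₚ (g *ₚ h)) (suc n) ∎
  where
  open ≡-Reasoning
  open ℚ-Solver
  tail-fg*h : (tail (f *ₚ g) *ₚ h) n ≡ f 0 ℚ.* (tail g *ₚ h) n ℚ.+ (tail f *ₚ (g *ₚ h)) n
  tail-fg*h = trans (*ₚ-congʳ h (*ₚ-at-suc f g) n)
    (trans (*ₚ-distribʳ (f 0 ·ₚ tail g) (tail f *ₚ g) h n)
      (cong₂ ℚ._+_ (·ₚ-*ₚ-assoc (f 0) (tail g) h n) (*ₚ-assoc (tail f) g h n)))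

≈ₚ-isEquivalence : IsEquivalence _≈ₚ_
≈ₚ-isEquivalence = record
  { refl  = λ _ → refl
  ; sym   = λ f≈g n → sym (f≈g n)
  ; trans = λ f≈g g≈h n → trans (f≈g n) (g≈h n)
  }

open IsEquivalence ≈ₚ-isEquivalence
  using () renaming (refl to ≈ₚ-refl; sym to ≈ₚ-sym; trans to ≈ₚ-trans)

infixr 4 _⟨≈⟩_

_⟨≈⟩_ : {a b c : PS} → a ≈ₚ b → b ≈ₚ c → a ≈ₚ c
_⟨≈⟩_ = ≈ₚ-trans

+ₚ-*ₚ-isCommutativeRing : IsCommutativeRing _≈ₚ_ _+ₚ_ _*ₚ_ -ₚ_ 0ₚ 1ₚ
+ₚ-*ₚ-isCommutativeRing = record
  { isRing = record
    { +-isAbelianGroup = record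
      { isGroup = record
        { isMonoid = record
          { isSemigroup = record
            { isMagma = record
              { isEquivalence = ≈ₚ-isEquivalence
              ; ∙-cong = λ a≈b c≈d n → cong₂ ℚ._+_ (a≈b n) (c≈d n)
              }
            ; assoc = λ a b c n → ℚₚ.+-assoc (a n) (b n) (c n)
            }
          ; identity = (λ a n → ℚₚ.+-identityˡ (a n)) , (λ a n → ℚₚ.+-identityʳ (a n))
          }
        ; inverse = (λ a n → ℚₚ.+-inverseˡ (a n)) , (λ a n → ℚₚ.+-inverseʳ (a n))
        ; ⁻¹-cong = λ a≈b n → cong -_ (a≈b n)
        }
      ; comm = λ a b n → ℚₚ.+-comm (a n) (b n)
      }
    ; *-cong = λ {a} {b} {c} {d} a≈b c≈d → *ₚ-congʳ c a≈b ⟨≈⟩ *ₚ-congˡ b c≈d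
    ; *-assoc = *ₚ-assoc
    ; *-identity = *ₚ-identityˡ , (λ a → *ₚ-comm a 1ₚ ⟨≈⟩ *ₚ-identityˡ a)
    ; distrib = (λ a b c → *ₚ-comm a (b +ₚ c) ⟨≈⟩ *ₚ-distribʳ b c a
                          ⟨≈⟩ (λ n → cong₂ ℚ._+_ (*ₚ-comm b a n) (*ₚ-comm c a n)))
              , (λ a b c → *ₚ-distribʳ b c a)
    }
  ; *-comm = *ₚ-comm
  }

+ₚ-*ₚ-commutativeRing : CommutativeRing 0ℓ 0ℓ
+ₚ-*ₚ-commutativeRing = record { isCommutativeRing = +ₚ-*ₚ-isCommutativeRing }

const-*ₚ-const : (p q : ℚ) → const p *ₚ const q ≈ₚ const (p ℚ.* q)
const-*ₚ-const p q zero = *ₚ-at-0 (const p) (const q)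
const-*ₚ-const p q (suc n) = trans (const-*ₚ p (const q) (suc n)) (ℚₚ.*-zeroʳ p)

const-morphism : ℚₚ.+-*-rawRing -Raw-AlmostCommutative⟶ fromCommutativeRing +ₚ-*ₚ-commutativeRing
const-morphism = record
  { ⟦_⟧    = const
  ; +-homo = λ { p q zero → refl ; p q (suc n) → sym (ℚₚ.+-identityˡ 0ℚ) }
  ; *-homo = λ p q → ≈ₚ-sym (const-*ₚ-const p q)
  ; -‿homo = λ { p zero → refl ; p (suc n) → refl }
  ; 0-homo = λ { zero → refl ; (suc n) → refl }
  ; 1-homo = λ n → refl
  }

const-cong : {p q : ℚ} → p ≡ q → const p ≈ₚ const q
const-cong p≡q n = cong (λ r → const r n) p≡q

const-≈ₚ? : (p q : ℚ) → Maybe (const p ≈ₚ const q)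
const-≈ₚ? p q = Maybe.map const-cong (dec⇒maybe (p ℚₚ.≟ q))

module PS-Solver = Algebra.Solver.Ring ℚₚ.+-*-rawRing
  (fromCommutativeRing +ₚ-*ₚ-commutativeRing) const-morphism const-≈ₚ?

open _-Raw-AlmostCommutative⟶_ const-morphism using (+-homo)

shift : PS → PS
shift g zero    = 0ℚ
shift g (suc n) = g n

shift-cong : {a b : PS} → a ≈ₚ b → shift a ≈ₚ shift b
shift-cong a≈b zero    = refl
shift-cong a≈b (suc n) = a≈b n

*ₚ-shift : (a g : PS) → a 0 ≡ 0ℚ → a *ₚ g ≈ₚ shift (tail a *ₚ g)
*ₚ-shift a g a₀≡0 zero = trans (*ₚ-at-0 a g) (trans (cong (ℚ._* g 0) a₀≡0) (ℚₚ.*-zeroˡ (g 0)))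
*ₚ-shift a g a₀≡0 (suc n) = trans (*ₚ-at-suc a g n)
  (trans (cong (ℚ._+ (tail a *ₚ g) n) (trans (cong (ℚ._* g (suc n)) a₀≡0) (ℚₚ.*-zeroˡ (g (suc n)))))
    (ℚₚ.+-identityˡ _))

X^1-*ₚ : (g : PS) → X^ 1 *ₚ g ≈ₚ shift g
X^1-*ₚ g = *ₚ-shift (X^ 1) g refl ⟨≈⟩ shift-cong (*ₚ-congʳ g tail-X^1 ⟨≈⟩ *ₚ-identityˡ g)
  where
  tail-X^1 : tail (X^ 1) ≈ₚ 1ₚ
  tail-X^1 zero    = refl
  tail-X^1 (suc n) = refl

X^2-*ₚ : (g : PS) → X^ 2 *ₚ g ≈ₚ shift (shift g)
X^2-*ₚ g = *ₚ-shift (X^ 2) g refl ⟨≈⟩ shift-cong (*ₚ-congʳ g tail-X^2 ⟨≈⟩ X^1-*ₚ g)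
  where
  tail-X^2 : tail (X^ 2) ≈ₚ X^ 1
  tail-X^2 zero          = refl
  tail-X^2 (suc zero)    = refl
  tail-X^2 (suc (suc n)) = refl

X^4≈X^2*X^2 : X^ 4 ≈ₚ X^ 2 *ₚ X^ 2
X^4≈X^2*X^2 = X^4≈shift⁴ ⟨≈⟩ ≈ₚ-sym (X^2-*ₚ (X^ 2))
  where
  X^4≈shift⁴ : X^ 4 ≈ₚ shift (shift (X^ 2))
  X^4≈shift⁴ 0 = refl
  X^4≈shift⁴ 1 = refl
  X^4≈shift⁴ 2 = refl
  X^4≈shift⁴ 3 = refl
  X^4≈shift⁴ 4 = refl
  X^4≈shift⁴ (suc (suc (suc (suc (suc n))))) = refl

X^2-*ₚ-cancel : {g : PS} → X^ 2 *ₚ g ≈ₚ 0ₚ → g ≈ₚ 0ₚ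
X^2-*ₚ-cancel {g} x²g≈0 n = trans (sym (X^2-*ₚ g (2 + n))) (x²g≈0 (2 + n))

inv₁-suc : (a : PS) (n : ℕ) → inv₁ a (suc n) ≡ - (tail a *ₚ inv₁ a) n
inv₁-suc a n = cong -_ (trans
  (foldr-zipWith-tabulate (suc n) (λ i → a (suc (toℕ i))) (λ i → a (suc i) ℚ.* inv₁ a (n ∸ i))
    (invVec a n) (λ i → cong (a (suc (toℕ i)) ℚ.*_) (lookup-invVec n i)))
  (sym (*ₚ-applyUpTo (tail a) (inv₁ a) n)))
  where
  lookup-invVec : (n : ℕ) (i : Fin (suc n)) → lookup (invVec a n) i ≡ inv₁ a (n ∸ toℕ i)
  lookup-invVec zero    fzero     = refl
  lookup-invVec (suc n) fzero     = refl
  lookup-invVec (suc n) (fsuc i)  = lookup-invVec n i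

  foldr-zipWith-tabulate : (m : ℕ) (g : Fin m → ℚ) (h : ℕ → ℚ) (w : Vec ℚ m) →
    ((i : Fin m) → g i ℚ.* lookup w i ≡ h (toℕ i)) →
    Vec.foldr _ ℚ._+_ 0ℚ (zipWith ℚ._*_ (tabulate g) w) ≡ sumℚ (applyUpTo h m)
  foldr-zipWith-tabulate zero    g h []      _   = refl
  foldr-zipWith-tabulate (suc m) g h (x ∷ w) g≡h =
    cong₂ ℚ._+_ (g≡h fzero)
      (foldr-zipWith-tabulate m (λ i → g (fsuc i)) (λ i → h (suc i)) w (λ i → g≡h (fsuc i)))

inv₁-inverseʳ : (a : PS) → a 0 ≡ 1ℚ → a *ₚ inv₁ a ≈ₚ 1ₚ
inv₁-inverseʳ a a₀≡1 zero = trans (*ₚ-at-0 a (inv₁ a)) (cong (ℚ._* 1ℚ) a₀≡1)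
inv₁-inverseʳ a a₀≡1 (suc n) = begin
    (a *ₚ inv₁ a) (suc n)
  ≡⟨ *ₚ-at-suc a (inv₁ a) n ⟩
    a 0 ℚ.* inv₁ a (suc n) ℚ.+ (tail a *ₚ inv₁ a) n
  ≡⟨ cong (ℚ._+ (tail a *ₚ inv₁ a) n) (cong₂ ℚ._*_ a₀≡1 (inv₁-suc a n)) ⟩
    1ℚ ℚ.* - (tail a *ₚ inv₁ a) n ℚ.+ (tail a *ₚ inv₁ a) n
  ≡⟨ cong (ℚ._+ (tail a *ₚ inv₁ a) n) (ℚₚ.*-identityˡ (- (tail a *ₚ inv₁ a) n)) ⟩
    - (tail a *ₚ inv₁ a) n ℚ.+ (tail a *ₚ inv₁ a) n
  ≡⟨ ℚₚ.+-inverseˡ ((tail a *ₚ inv₁ a) n) ⟩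
    0ℚ ∎
  where open ≡-Reasoning

inv₁-unique : (a b : PS) → a 0 ≡ 1ℚ → b *ₚ a ≈ₚ 1ₚ → b ≈ₚ inv₁ a
inv₁-unique a b a₀≡1 ba≈1 = begin
  b                   ≈⟨ *-identityʳ b ⟨
  b *ₚ 1ₚ             ≈⟨ *ₚ-congˡ b (inv₁-inverseʳ a a₀≡1) ⟨
  b *ₚ (a *ₚ inv₁ a)  ≈⟨ *-assoc b a (inv₁ a) ⟨
  (b *ₚ a) *ₚ inv₁ a  ≈⟨ *ₚ-congʳ (inv₁ a) ba≈1 ⟩
  1ₚ *ₚ inv₁ a        ≈⟨ *-identityˡ (inv₁ a) ⟩
  inv₁ a              ∎
  where
  open CommutativeRing +ₚ-*ₚ-commutativeRing using (setoid; *-identityʳ; *-identityˡ; *-assoc)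
  open import Relation.Binary.Reasoning.Setoid setoid

-- Convergence of J-fractions

_≈ₚ_below_ : PS → PS → ℕ → Set
f ≈ₚ g below d = ∀ i → i < d → f i ≡ g i

infix 4 _≈ₚ_below_

≈ₚ-below-suc : {f g : PS} {d : ℕ} → f ≈ₚ g below d → f d ≡ g d → f ≈ₚ g below suc d
≈ₚ-below-suc f≈g fd≡gd i i<1+d with ℕₚ.m<1+n⇒m<n∨m≡n i<1+d
... | inj₁ i<d  = f≈g i i<d
... | inj₂ refl = fd≡gd

*ₚ-cong-below : {d : ℕ} {f f' g g' : PS} →
  f ≈ₚ f' below d → g ≈ₚ g' below d → f *ₚ g ≈ₚ f' *ₚ g' below d
*ₚ-cong-below {f = f} {f'} {g} {g'} f≈f' g≈g' zero 0<d =
  trans (*ₚ-at-0 f g) (trans (cong₂ ℚ._*_ (f≈f' 0 0<d) (g≈g' 0 0<d)) (sym (*ₚ-at-0 f' g')))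
*ₚ-cong-below {suc d} {f} {f'} {g} {g'} f≈f' g≈g' (suc n) (s≤s n<d) = trans (*ₚ-at-suc f g n) (trans
  (cong₂ ℚ._+_ (cong₂ ℚ._*_ (f≈f' 0 z<s) (g≈g' (suc n) (s≤s n<d)))
    (*ₚ-cong-below {d} (λ i i<d → f≈f' (suc i) (s≤s i<d)) (λ i i<d → g≈g' i (ℕₚ.m<n⇒m<1+n i<d))
      n n<d))
  (sym (*ₚ-at-suc f' g' n)))

inv₁-cong-below : {d : ℕ} {a b : PS} → a ≈ₚ b below d → inv₁ a ≈ₚ inv₁ b below d
inv₁-cong-below {d} {a} {b} a≈b i i<d = prefix i i<d i ℕₚ.≤-refl
  where
  prefix : ∀ n → n < d → inv₁ a ≈ₚ inv₁ b below suc n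
  prefix zero    _    zero    _         = refl
  prefix zero    _    (suc i) (s≤s ())
  prefix (suc n) n<d  = ≈ₚ-below-suc (prefix n (ℕₚ.<⇒≤ n<d))
    (trans (inv₁-suc a n) (trans
      (cong -_ (*ₚ-cong-below (λ j j<1+n → a≈b (suc j) (ℕₚ.≤-<-trans j<1+n n<d)) (prefix n (ℕₚ.<⇒≤ n<d))
        n ℕₚ.≤-refl))
      (sym (inv₁-suc b n))))

denominator : ℚ → ℚ → PS → PS
denominator uᵢ vᵢ t = const 1ℚ +ₚ uᵢ ·ₚ X^ 1 -ₚ vᵢ ·ₚ (X^ 2 *ₚ t)

denominator-cong-below : (uᵢ vᵢ : ℚ) {d : ℕ} {t t' : PS} →
  t ≈ₚ t' below d → denominator uᵢ vᵢ t ≈ₚ denominator uᵢ vᵢ t' below 2 + d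
denominator-cong-below uᵢ vᵢ {d} {t} {t'} t≈t' i i<2+d =
  cong (λ z → (const 1ℚ i ℚ.+ uᵢ ℚ.* X^ 1 i) ℚ.- vᵢ ℚ.* z)
    (trans (X^2-*ₚ t i) (trans (shift²-cong i i<2+d) (sym (X^2-*ₚ t' i))))
  where
  shift²-cong : shift (shift t) ≈ₚ shift (shift t') below 2 + d
  shift²-cong 0             _                = refl
  shift²-cong 1             _                = refl
  shift²-cong (suc (suc j)) (s≤s (s≤s j<d)) = t≈t' j j<d

isJFraction-from-tails : {f : PS} (u v : ℕ → ℚ) (T : ℕ → PS) →
  f ≈ₚ v 0 ·ₚ T 0 →
  (∀ i → T i ≈ₚ inv₁ (denominator (u (suc i)) (v (suc i)) (T (suc i)))) →
  IsJFraction f u v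
isJFraction-from-tails u v T f≈v₀T₀ T-rec n =
  suc n , λ m n<m → trans (cong (v 0 ℚ.*_) (G≈T m 0 n n<m)) (sym (f≈v₀T₀ n))
  where
  G≈T : ∀ m i → G u v m (suc i) ≈ₚ T i below m
  G≈T zero    i j ()
  G≈T (suc m) i j j<1+m = trans
    (inv₁-cong-below (denominator-cong-below (u (suc i)) (v (suc i)) (G≈T m (suc i))) j (ℕₚ.m<n⇒m<1+n j<1+m))
    (sym (T-rec i j))

-- The quadratic equation of f

open import Algebra.Properties.Group (CommutativeRing.+-group +ₚ-*ₚ-commutativeRing)
  using () renaming (x≈y⇒x∙y⁻¹≈ε to f≈g⇒f-g≈0; x∙y⁻¹≈ε⇒x≈y to f-g≈0⇒f≈g)

-- The algebraic steps below exhibit a difference of series as a combination c₁h₁ + c₂h₂ + … of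
-- defects hᵢ that vanish by hypothesis (a polynomial identity, certified by the ring solver with
-- the rational parameters K, P, c as indeterminates); x+c*h≈x then discards the defects one by one.
x+c*h≈x : {x : PS} (c : PS) {h : PS} → h ≈ₚ 0ₚ → x +ₚ c *ₚ h ≈ₚ x
x+c*h≈x {x} c {h} h≈0 n =
  trans (cong (x n ℚ.+_) (trans (*ₚ-congˡ c h≈0 n) (*ₚ-zeroʳ c n)))
    (ℚₚ.+-identityʳ (x n))

Y : PS
Y = X^ 2

quadratic-equation : (s f : PS) →
  s *ₚ s ≈ₚ const 1ℚ -ₚ (+ 4 / 1) ·ₚ (X^ 4 *ₚ inv₁ (const 1ℚ -ₚ X^ 2)) →
  (+ 2 / 1) ·ₚ (X^ 4 *ₚ f) ≈ₚ const 1ℚ -ₚ s →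
  (1ₚ -ₚ Y) *ₚ (f -ₚ Y *ₚ Y *ₚ f *ₚ f) ≈ₚ 1ₚ
quadratic-equation s f s²≈ 2X⁴f≈ =
  *ₚ-congˡ (1ₚ -ₚ Y)
    (f-g≈0⇒f≈g (f -ₚ Y *ₚ Y *ₚ f *ₚ f) R (X^2-*ₚ-cancel (X^2-*ₚ-cancel Y²[f-Y²f²-R]≈0)))
  ⟨≈⟩ inv₁-inverseʳ (1ₚ -ₚ Y) refl
  where
  R : PS
  R = inv₁ (1ₚ -ₚ Y)

  s²-defect : PS
  s²-defect = s *ₚ s -ₚ (1ₚ -ₚ const (+ 4 / 1) *ₚ (Y *ₚ Y *ₚ R))

  f-defect : PS
  f-defect = const (+ 2 / 1) *ₚ (Y *ₚ Y *ₚ f) -ₚ (1ₚ -ₚ s)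

  s²-defect≈0 : s²-defect ≈ₚ 0ₚ
  s²-defect≈0 = f≈g⇒f-g≈0 (λ n → trans (s²≈ n) (cong (λ z → 1ₚ n ℚ.- z)
    (trans (cong ((+ 4 / 1) ℚ.*_) (*ₚ-congʳ R X^4≈X^2*X^2 n)) (sym (const-*ₚ (+ 4 / 1) (Y *ₚ Y *ₚ R) n)))))

  f-defect≈0 : f-defect ≈ₚ 0ₚ
  f-defect≈0 = f≈g⇒f-g≈0 (λ n → trans (const-*ₚ (+ 2 / 1) (Y *ₚ Y *ₚ f) n)
    (trans (cong ((+ 2 / 1) ℚ.*_) (*ₚ-congʳ f (≈ₚ-sym X^4≈X^2*X^2) n)) (2X⁴f≈ n)))

  c₁ c₂ : PS
  c₁ = const (- (+ 1 / 4))
  c₂ = const (+ 1 / 4) *ₚ (1ₚ +ₚ s -ₚ const (+ 2 / 1) *ₚ (Y *ₚ Y *ₚ f))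

  -- s² - (1 - 2Y²f)² = (s - 1 + 2Y²f)(s + 1 - 2Y²f), and s - 1 + 2Y²f is f-defect.
  Y²[f-Y²f²-R]≈defects :
    Y *ₚ (Y *ₚ (f -ₚ Y *ₚ Y *ₚ f *ₚ f -ₚ R)) ≈ₚ c₁ *ₚ s²-defect +ₚ c₂ *ₚ f-defect
  Y²[f-Y²f²-R]≈defects = solve 4 (λ s f Y R →
      Y :* (Y :* (f :- Y :* Y :* f :* f :- R)) :=
      con (- (+ 1 / 4)) :* (s :* s :- (con 1ℚ :- con (+ 4 / 1) :* (Y :* Y :* R)))
      :+ con (+ 1 / 4) :* (con 1ℚ :+ s :- con (+ 2 / 1) :* (Y :* Y :* f))
         :* (con (+ 2 / 1) :* (Y :* Y :* f) :- (con 1ℚ :- s)))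
    ≈ₚ-refl s f Y R
    where open PS-Solver

  Y²[f-Y²f²-R]≈0 : Y *ₚ (Y *ₚ (f -ₚ Y *ₚ Y *ₚ f *ₚ f -ₚ R)) ≈ₚ 0ₚ
  Y²[f-Y²f²-R]≈0 = Y²[f-Y²f²-R]≈defects
    ⟨≈⟩ x+c*h≈x c₂ f-defect≈0
    ⟨≈⟩ *ₚ-congˡ c₁ s²-defect≈0
    ⟨≈⟩ *ₚ-zeroʳ c₁

-- The tails of the J-fraction of f

-- A literal + n / 1 is normalised by a gcd that does not compute for a variable n, hence the
-- detour through unnormalised rationals.
k+1≡suc-k : (k : ℕ) → (+ k / 1) ℚ.+ 1ℚ ≡ + suc k / 1
k+1≡suc-k k = ℚₚ.toℚᵘ-injective (begin-equality
  ℚ.toℚᵘ ((+ k / 1) ℚ.+ 1ℚ)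
    ≃⟨ ℚₚ.toℚᵘ-homo-+ (+ k / 1) 1ℚ ⟩
  ℚ.toℚᵘ (+ k / 1) ℚᵘ.+ ℚ.toℚᵘ 1ℚ
    ≃⟨ ℚᵘₚ.+-cong (ℚₚ.toℚᵘ-fromℚᵘ (ℚᵘ.mkℚᵘ (+ k) 0)) (ℚₚ.toℚᵘ-fromℚᵘ (ℚᵘ.mkℚᵘ (+ 1) 0)) ⟩
  ℚᵘ.mkℚᵘ (+ k) 0 ℚᵘ.+ ℚᵘ.mkℚᵘ (+ 1) 0
    ≃⟨ ℚᵘ.*≡* (solve 1 (λ x → (x :* con (+ 1) :+ con (+ 1) :* con (+ 1)) :* con (+ 1)
                            := (con (+ 1) :+ x) :* (con (+ 1) :* con (+ 1))) refl (+ k)) ⟩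
  ℚᵘ.mkℚᵘ (+ suc k) 0
    ≃⟨ ℚₚ.toℚᵘ-fromℚᵘ (ℚᵘ.mkℚᵘ (+ suc k) 0) ⟨
  ℚ.toℚᵘ (+ suc k / 1) ∎)
  where
  open ℚᵘₚ.≤-Reasoning
  open ℤ-Solver

1/suc-k*suc-k≡1 : (k : ℕ) → (+ 1 / suc k) ℚ.* (+ suc k / 1) ≡ 1ℚ
1/suc-k*suc-k≡1 k = ℚₚ.toℚᵘ-injective (begin-equality
  ℚ.toℚᵘ ((+ 1 / suc k) ℚ.* (+ suc k / 1))
    ≃⟨ ℚₚ.toℚᵘ-homo-* (+ 1 / suc k) (+ suc k / 1) ⟩
  ℚ.toℚᵘ (+ 1 / suc k) ℚᵘ.* ℚ.toℚᵘ (+ suc k / 1)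
    ≃⟨ ℚᵘₚ.*-cong (ℚₚ.toℚᵘ-fromℚᵘ (ℚᵘ.mkℚᵘ (+ 1) k)) (ℚₚ.toℚᵘ-fromℚᵘ (ℚᵘ.mkℚᵘ (+ suc k) 0)) ⟩
  ℚᵘ.mkℚᵘ (+ 1) k ℚᵘ.* ℚᵘ.mkℚᵘ (+ suc k) 0
    ≃⟨ ℚᵘ.*≡* (cong (λ n → + suc n) (solve 1 (λ n → (n :+ con 0 :* (con 1 :+ n)) :* con 1
                                                 := n :* con 1 :+ con 0 :* (con 1 :+ n :* con 1)) refl k)) ⟩
  ℚ.toℚᵘ 1ℚ ∎)
  where
  open ℚᵘₚ.≤-Reasoning
  open ℕ-Solver

4k+[5+r]≡4[1+k]+[1+r] : ∀ k r → 4 * k + (5 + r) ≡ 4 * suc k + suc r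
4k+[5+r]≡4[1+k]+[1+r] =
  solve 2 (λ k r → con 4 :* k :+ (con 5 :+ r) := con 4 :* (con 1 :+ k) :+ (con 1 :+ r)) refl
  where open ℕ-Solver

const-neg : (q : ℚ) → const (- q) +ₚ const q ≈ₚ 0ₚ
const-neg q zero    = ℚₚ.+-inverseˡ q
const-neg q (suc n) = refl

cP-1≈0 : (c P : ℚ) → c ℚ.* P ≡ 1ℚ → const c *ₚ const P -ₚ 1ₚ ≈ₚ 0ₚ
cP-1≈0 c P cP≡1 = f≈g⇒f-g≈0 (const-*ₚ-const c P ⟨≈⟩ const-cong cP≡1)

K+1-P≈0 : (K P : ℚ) → K ℚ.+ 1ℚ ≡ P → const K +ₚ 1ₚ -ₚ const P ≈ₚ 0ₚ
K+1-P≈0 K P K+1≡P = f≈g⇒f-g≈0 (≈ₚ-sym (+-homo K 1ℚ) ⟨≈⟩ const-cong K+1≡P)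

1-wYt : ℚ → PS → PS
1-wYt w t = 1ₚ -ₚ const w *ₚ (Y *ₚ t)

1-wYt-at-0 : (w : ℚ) (t : PS) → 1-wYt w t 0 ≡ 1ℚ
1-wYt-at-0 w t = cong (λ z → 1ℚ ℚ.- z)
  (trans (*ₚ-at-0 (const w) (Y *ₚ t)) (trans (cong (w ℚ.*_) (X^2-*ₚ t 0)) (ℚₚ.*-zeroʳ w)))

reciprocal-step : (T T' : PS) (w : ℚ) → T *ₚ 1-wYt w T' ≈ₚ 1ₚ → T ≈ₚ inv₁ (denominator 0ℚ w T')
reciprocal-step T T' w T*d≈1 =
  inv₁-unique (denominator 0ℚ w T') T (trans (den≈1-wYt 0) (1-wYt-at-0 w T'))
    (*ₚ-congˡ T den≈1-wYt ⟨≈⟩ T*d≈1)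
  where
  den≈1-wYt : denominator 0ℚ w T' ≈ₚ 1-wYt w T'
  den≈1-wYt n = cong₂ ℚ._-_
    (trans (cong (1ₚ n ℚ.+_) (ℚₚ.*-zeroˡ (X^ 1 n))) (ℚₚ.+-identityʳ (1ₚ n)))
    (sym (const-*ₚ w (Y *ₚ T') n))

module Tails (F : PS) (key : (1ₚ -ₚ Y) *ₚ (F -ₚ Y *ₚ Y *ₚ F *ₚ F) ≈ₚ 1ₚ) where

  D : ℚ → PS
  D P = 1-wYt P F

  A : ℚ → PS
  A K = F *ₚ inv₁ (D K)

  B : ℚ → PS
  B c = 1ₚ +ₚ const c *ₚ (Y *ₚ (1ₚ -ₚ Y) *ₚ F)

  E : ℚ → PS
  E c = 1ₚ +ₚ const c *ₚ Y -ₚ Y *ₚ Y *ₚ F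

  C : ℚ → PS
  C c = inv₁ (E c)

  key-defect : PS
  key-defect = (1ₚ -ₚ Y) *ₚ (F -ₚ Y *ₚ Y *ₚ F *ₚ F) -ₚ 1ₚ

  D-defect : ℚ → PS
  D-defect K = D K *ₚ inv₁ (D K) -ₚ 1ₚ

  E-defect : ℚ → PS
  E-defect c = E c *ₚ C c -ₚ 1ₚ

  key-defect≈0 : key-defect ≈ₚ 0ₚ
  key-defect≈0 = f≈g⇒f-g≈0 key

  D-defect≈0 : (K : ℚ) → D-defect K ≈ₚ 0ₚ
  D-defect≈0 K = f≈g⇒f-g≈0 (inv₁-inverseʳ (D K) (1-wYt-at-0 K F))

  E-defect≈0 : (c : ℚ) → E-defect c ≈ₚ 0ₚ
  E-defect≈0 c = f≈g⇒f-g≈0 (inv₁-inverseʳ (E c) E₀≡1)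
    where
    E₀≡1 : E c 0 ≡ 1ℚ
    E₀≡1 = cong₂ (λ a b → (1ℚ ℚ.+ a) ℚ.- b)
      (trans (*ₚ-at-0 (const c) Y) (ℚₚ.*-zeroʳ c))
      (trans (*ₚ-at-0 (Y *ₚ Y) F) (trans (cong (ℚ._* F 0) (*ₚ-at-0 Y Y)) (ℚₚ.*-zeroˡ (F 0))))

  A-step : (K P c : ℚ) → K ℚ.+ 1ℚ ≡ P → c ℚ.* P ≡ 1ℚ → A K ≈ₚ inv₁ (denominator 0ℚ P (B c))
  A-step K P c K+1≡P cP≡1 = reciprocal-step (A K) (B c) P
    (identity ⟨≈⟩ x+c*h≈x c₄ (cP-1≈0 c P cP≡1) ⟨≈⟩ x+c*h≈x c₃ (K+1-P≈0 K P K+1≡P)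
      ⟨≈⟩ x+c*h≈x I key-defect≈0 ⟨≈⟩ x+c*h≈x 1ₚ (D-defect≈0 K))
    where
    I c₃ c₄ : PS
    I = inv₁ (D K)
    c₃ = I *ₚ Y *ₚ F
    c₄ = -ₚ (I *ₚ Y *ₚ Y *ₚ (1ₚ -ₚ Y) *ₚ F *ₚ F)
    identity : A K *ₚ 1-wYt P (B c) ≈ₚ
      1ₚ +ₚ 1ₚ *ₚ D-defect K +ₚ I *ₚ key-defect
        +ₚ c₃ *ₚ (const K +ₚ 1ₚ -ₚ const P) +ₚ c₄ *ₚ (const c *ₚ const P -ₚ 1ₚ)
    identity = solve 6 (λ F Y I K P c →
        F :* I :* (con 1ℚ :- P :* (Y :* (con 1ℚ :+ c :* (Y :* (con 1ℚ :- Y) :* F)))) :=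
        con 1ℚ :+ con 1ℚ :* ((con 1ℚ :- K :* (Y :* F)) :* I :- con 1ℚ)
          :+ I :* ((con 1ℚ :- Y) :* (F :- Y :* Y :* F :* F) :- con 1ℚ)
          :+ I :* Y :* F :* (K :+ con 1ℚ :- P)
          :+ :- (I :* Y :* Y :* (con 1ℚ :- Y) :* F :* F) :* (c :* P :- con 1ℚ))
      ≈ₚ-refl F Y I (const K) (const P) (const c)
      where open PS-Solver

  B-step : (c : ℚ) → B c ≈ₚ inv₁ (denominator 0ℚ c (C c))
  B-step c = reciprocal-step (B c) (C c) c
    (identity ⟨≈⟩ x+c*h≈x (const c *ₚ Y *ₚ C c) key-defect≈0 ⟨≈⟩ x+c*h≈x (1ₚ -ₚ B c) (E-defect≈0 c))
    where
    identity : B c *ₚ 1-wYt c (C c) ≈ₚ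
      1ₚ +ₚ (1ₚ -ₚ B c) *ₚ E-defect c +ₚ (const c *ₚ Y *ₚ C c) *ₚ key-defect
    identity = solve 4 (λ F Y J c →
        (con 1ℚ :+ c :* (Y :* (con 1ℚ :- Y) :* F)) :* (con 1ℚ :- c :* (Y :* J)) :=
        con 1ℚ
          :+ (con 1ℚ :- (con 1ℚ :+ c :* (Y :* (con 1ℚ :- Y) :* F)))
             :* ((con 1ℚ :+ c :* Y :- Y :* Y :* F) :* J :- con 1ℚ)
          :+ c :* Y :* J :* ((con 1ℚ :- Y) :* (F :- Y :* Y :* F :* F) :- con 1ℚ))
      ≈ₚ-refl F Y (C c) (const c)
      where open PS-Solver

  C-step : (c P : ℚ) → c ℚ.* P ≡ 1ℚ → C c ≈ₚ inv₁ (denominator 0ℚ (- c) (D P))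
  C-step c P cP≡1 = reciprocal-step (C c) (D P) (- c)
    (identity ⟨≈⟩ x+c*h≈x c₃ (const-neg c) ⟨≈⟩ x+c*h≈x c₂ (cP-1≈0 c P cP≡1)
      ⟨≈⟩ x+c*h≈x 1ₚ (E-defect≈0 c))
    where
    c₂ c₃ : PS
    c₂ = -ₚ (C c *ₚ Y *ₚ Y *ₚ F)
    c₃ = -ₚ (C c *ₚ Y *ₚ D P)
    identity : C c *ₚ 1-wYt (- c) (D P) ≈ₚ
      1ₚ +ₚ 1ₚ *ₚ E-defect c +ₚ c₂ *ₚ (const c *ₚ const P -ₚ 1ₚ) +ₚ c₃ *ₚ (const (- c) +ₚ const c)
    identity = solve 6 (λ F Y J c P N →
        J :* (con 1ℚ :- N :* (Y :* (con 1ℚ :- P :* (Y :* F)))) :=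
        con 1ℚ :+ con 1ℚ :* ((con 1ℚ :+ c :* Y :- Y :* Y :* F) :* J :- con 1ℚ)
          :+ :- (J :* Y :* Y :* F) :* (c :* P :- con 1ℚ)
          :+ :- (J :* Y :* (con 1ℚ :- P :* (Y :* F))) :* (N :+ c))
      ≈ₚ-refl F Y (C c) (const c) (const P) (const (- c))
      where open PS-Solver

  D-step : (P : ℚ) → D P ≈ₚ inv₁ (denominator 0ℚ (- P) (A P))
  D-step P = reciprocal-step (D P) (A P) (- P)
    (identity ⟨≈⟩ x+c*h≈x c₂ (const-neg P) ⟨≈⟩ x+c*h≈x (const P *ₚ (Y *ₚ F)) (D-defect≈0 P))
    where
    c₂ : PS
    c₂ = -ₚ (D P *ₚ Y *ₚ A P)
    identity : D P *ₚ 1-wYt (- P) (A P) ≈ₚ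
      1ₚ +ₚ const P *ₚ (Y *ₚ F) *ₚ D-defect P +ₚ c₂ *ₚ (const (- P) +ₚ const P)
    identity = solve 5 (λ F Y I P N →
        (con 1ℚ :- P :* (Y :* F)) :* (con 1ℚ :- N :* (Y :* (F :* I))) :=
        con 1ℚ :+ P :* (Y :* F) :* ((con 1ℚ :- P :* (Y :* F)) :* I :- con 1ℚ)
          :+ :- ((con 1ℚ :- P :* (Y :* F)) :* Y :* (F :* I)) :* (N :+ P))
      ≈ₚ-refl F Y (inv₁ (D P)) (const P) (const (- P))
      where open PS-Solver

  A-zero : A 0ℚ ≈ₚ F
  A-zero = *ₚ-congˡ F (≈ₚ-sym 1≈inv₁[D0]) ⟨≈⟩ *ₚ-comm F 1ₚ ⟨≈⟩ *ₚ-identityˡ F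
    where
    D0≈1 : D 0ℚ ≈ₚ 1ₚ
    D0≈1 n = trans (cong (λ z → 1ₚ n ℚ.- z) (trans (const-*ₚ 0ℚ (Y *ₚ F) n) (ℚₚ.*-zeroˡ ((Y *ₚ F) n))))
      (ℚₚ.+-identityʳ (1ₚ n))
    1≈inv₁[D0] : 1ₚ ≈ₚ inv₁ (D 0ℚ)
    1≈inv₁[D0] = inv₁-unique (D 0ℚ) 1ₚ (1-wYt-at-0 0ℚ F) (*ₚ-identityˡ (D 0ℚ) ⟨≈⟩ D0≈1)

  block : ℕ → ℕ → PS
  block k 0 = A (+ k / 1)
  block k 1 = B (+ 1 / suc k)
  block k 2 = C (+ 1 / suc k)
  block k 3 = D (+ suc k / 1)
  block k (suc (suc (suc (suc r)))) = block (suc k) r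

  block-recurrence : (v : ℕ → ℚ) →
    (∀ k → v (4 * k + 1) ≡ + suc k / 1) →
    (∀ k → v (4 * k + 2) ≡ + 1 / suc k) →
    (∀ k → v (4 * k + 3) ≡ - (+ 1 / suc k)) →
    (∀ k → v (4 * k + 4) ≡ - (+ suc k / 1)) →
    ∀ k i → block k i ≈ₚ inv₁ (denominator 0ℚ (v (4 * k + suc i)) (block k (suc i)))
  block-recurrence v v₄ₖ₊₁ _ _ _ k 0 rewrite v₄ₖ₊₁ k =
    A-step (+ k / 1) (+ suc k / 1) (+ 1 / suc k) (k+1≡suc-k k) (1/suc-k*suc-k≡1 k)
  block-recurrence v _ v₄ₖ₊₂ _ _ k 1 rewrite v₄ₖ₊₂ k = B-step (+ 1 / suc k)
  block-recurrence v _ _ v₄ₖ₊₃ _ k 2 rewrite v₄ₖ₊₃ k = C-step (+ 1 / suc k) (+ suc k / 1) (1/suc-k*suc-k≡1 k)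
  block-recurrence v _ _ _ v₄ₖ₊₄ k 3 rewrite v₄ₖ₊₄ k = D-step (+ suc k / 1)
  block-recurrence v v₄ₖ₊₁ v₄ₖ₊₂ v₄ₖ₊₃ v₄ₖ₊₄ k (suc (suc (suc (suc r))))
    rewrite 4k+[5+r]≡4[1+k]+[1+r] k r = block-recurrence v v₄ₖ₊₁ v₄ₖ₊₂ v₄ₖ₊₃ v₄ₖ₊₄ (suc k) r

proposition3p1 : (s f : PS) (v : ℕ → ℚ) →
    s 0 ≡ 1ℚ →
    s *ₚ s ≈ₚ const 1ℚ -ₚ (+ 4 / 1) ·ₚ (X^ 4 *ₚ inv₁ (const 1ℚ -ₚ X^ 2)) →
    (+ 2 / 1) ·ₚ (X^ 4 *ₚ f) ≈ₚ const 1ℚ -ₚ s →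
    v 0 ≡ 1ℚ →
    (∀ k → v (4 * k + 1) ≡ + suc k / 1) →
    (∀ k → v (4 * k + 2) ≡ + 1 / suc k) →
    (∀ k → v (4 * k + 3) ≡ - (+ 1 / suc k)) →
    (∀ k → v (4 * k + 4) ≡ - (+ suc k / 1)) →
    IsJFraction f (λ _ → 0ℚ) v
proposition3p1 s f v _ s²≈ 2X⁴f≈ v₀≡1 v₄ₖ₊₁ v₄ₖ₊₂ v₄ₖ₊₃ v₄ₖ₊₄ =
  isJFraction-from-tails (λ _ → 0ℚ) v (block 0) f≈v₀T₀
    (block-recurrence v v₄ₖ₊₁ v₄ₖ₊₂ v₄ₖ₊₃ v₄ₖ₊₄ 0)
  where
  open Tails f (quadratic-equation s f s²≈ 2X⁴f≈)

  f≈v₀T₀ : f ≈ₚ v 0 ·ₚ A 0ℚ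
  f≈v₀T₀ n rewrite v₀≡1 = sym (trans (ℚₚ.*-identityˡ (A 0ℚ n)) (A-zero n))
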